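{- Let $M$ be an $n\times n$ array with entries from $A=\{1,\ldots,n\}$ having property $P_1$, and let $(A,*)$ be the associated groupoid ($a*b$ is the entry of $M$ in row $a$, column $b$). Then $M$ has a transversal if and only if $(A,*)$ is isotopic to an idempotent groupoid $(A,+)$ (i.e. one with $a+a=a$ for all $a\in A$).
   Context: An $n\times n$ array with entries from $\{1,\ldots,n\}$ has property $P_1$ iff whenever two distinct symbols appear together in some row they never appear together in any column, and vice versa. A transversal of such an array is a set of $n$ cells containing exactly one cell in each row, exactly one in each column, and exactly one cell containing each symbol. Two groupoids $(A,+)$ and $(B,*)$ are isotopic iff there exist bijections $\alpha,\beta,\gamma:B\to A$ such that $\alpha(a)+\beta(b)=\gamma(a*b)$ for all $a,b\in B$. -}

module Defs where

open import Data.Nat using (ℕ)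
open import Data.Fin using (Fin)
open import Data.Product using (Σ; ∃; _×_; _,_)
open import Relation.Binary.PropositionalEquality using (_≡_; _≢_)
open import Relation.Nullary using (¬_)
open import Function.Bundles using (_⤖_; Bijection)

Array : ℕ → Set
Array n = Fin n → Fin n → Fin n

TogetherInRow : ∀ {n} → Array n → Fin n → Fin n → Fin n → Set
TogetherInRow M r x y = (∃ λ c → M r c ≡ x) × (∃ λ c → M r c ≡ y)

TogetherInCol : ∀ {n} → Array n → Fin n → Fin n → Fin n → Set
TogetherInCol M c x y = (∃ λ r → M r c ≡ x) × (∃ λ r → M r c ≡ y)

P₁ : ∀ {n} → Array n → Set
P₁ {n} M =
  (∀ (x y : Fin n) → x ≢ y →
     (∃ λ r → TogetherInRow M r x y) → ∀ c → ¬ TogetherInCol M c x y)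
  × (∀ (x y : Fin n) → x ≢ y →
     (∃ λ c → TogetherInCol M c x y) → ∀ r → ¬ TogetherInRow M r x y)

-- Encoded as a bijection σ from rows to columns
-- (cells (r , σ r)) such that r ↦ M r (σ r) is a bijection rows → symbols.
Transversal : ∀ {n} → Array n → Set
Transversal {n} M =
  Σ (Fin n ⤖ Fin n) λ σ →
    Σ (Fin n ⤖ Fin n) λ τ →
      ∀ r → Bijection.to τ r ≡ M r (Bijection.to σ r)

HasTransversal : ∀ {n} → Array n → Set
HasTransversal M = Transversal M

Op : ℕ → Set
Op n = Fin n → Fin n → Fin n

Isotopic : ∀ {n} → Op n → Op n → Set
Isotopic {n} _+_ _*_ =
  Σ (Fin n ⤖ Fin n) λ α → Σ (Fin n ⤖ Fin n) λ β → Σ (Fin n ⤖ Fin n) λ γ →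
    ∀ a b → Bijection.to α a + Bijection.to β b ≡ Bijection.to γ (a * b)

Idempotent : ∀ {n} → Op n → Set
Idempotent {n} _+_ = ∀ (a : Fin n) → a + a ≡ a

module Submission where

-- A transversal of an n×n array M is the same thing as an idempotent
-- isotope of its groupoid (a ∗ b = M a b).
--
--  * Transversal ⇒ isotope.  If the cells (r , σ r) form a transversal whose
--    symbols are τ r = M r (σ r), put  x + y = τ⁻¹ (M x (σ y)).  Then
--    (id , σ⁻¹ , τ⁻¹) is an isotopy from ∗ to +, and x + x = τ⁻¹ (τ x) = x.
--  * Isotope ⇒ transversal.  If α a + β b = γ (a ∗ b) with + idempotent, the
--    cells (r , β⁻¹ (α r)) form a transversal with symbol map γ⁻¹ ∘ α, since
--    γ (M r (β⁻¹ (α r))) = α r + α r = α r.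

open import Defs
open import Level using (Level)
open import Data.Nat using (ℕ)
open import Data.Fin using (Fin)
open import Data.Product using (Σ; _×_; _,_; proj₂)
open import Function.Bundles using (_⇔_; mk⇔; _⤖_; Bijection)
open import Function.Construct.Identity using (⤖-id)
open import Function.Construct.Symmetry using (⤖-sym)
open import Function.Construct.Composition using (_⤖-∘_)
open import Relation.Binary.PropositionalEquality
  using (_≡_; refl; sym; cong; module ≡-Reasoning)

private
  variable
    a b : Level
    A : Set a
    B : Set b

⟦_⟧ : A ⤖ B → A → B
⟦ f ⟧ = Bijection.to f

_⁻¹ : A ⤖ B → B ⤖ A
f ⁻¹ = ⤖-sym f

right-cancel : (f : A ⤖ B) (y : B) → ⟦ f ⟧ (⟦ f ⁻¹ ⟧ y) ≡ y
right-cancel f y = proj₂ (Bijection.surjective f y) refl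

left-cancel : (f : A ⤖ B) (x : A) → ⟦ f ⁻¹ ⟧ (⟦ f ⟧ x) ≡ x
left-cancel f x = Bijection.injective f (right-cancel f (⟦ f ⟧ x))

transversal⇒idempotentIsotope : ∀ {n} (M : Array n) → Transversal M →
  Σ (Op n) λ _+_ → Idempotent _+_ × Isotopic _+_ M
transversal⇒idempotentIsotope M (σ , τ , τ≡diagonal) =
  _+_ , idempotent , ⤖-id _ , σ ⁻¹ , τ ⁻¹ , isotopy
  where
  _+_ : Op _
  x + y = ⟦ τ ⁻¹ ⟧ (M x (⟦ σ ⟧ y))

  idempotent : Idempotent _+_
  idempotent x = begin
    ⟦ τ ⁻¹ ⟧ (M x (⟦ σ ⟧ x))  ≡⟨ cong ⟦ τ ⁻¹ ⟧ (sym (τ≡diagonal x)) ⟩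
    ⟦ τ ⁻¹ ⟧ (⟦ τ ⟧ x)        ≡⟨ left-cancel τ x ⟩
    x                         ∎
    where open ≡-Reasoning

  isotopy : ∀ a b → a + ⟦ σ ⁻¹ ⟧ b ≡ ⟦ τ ⁻¹ ⟧ (M a b)
  isotopy a b = cong (λ c → ⟦ τ ⁻¹ ⟧ (M a c)) (right-cancel σ b)

idempotentIsotope⇒transversal : ∀ {n} (M : Array n) →
  Σ (Op n) (λ _+_ → Idempotent _+_ × Isotopic _+_ M) → Transversal M
idempotentIsotope⇒transversal M (_+_ , idempotent , α , β , γ , isotopy) =
  β ⁻¹ ⤖-∘ α , γ ⁻¹ ⤖-∘ α , diagonal
  where
  diagonal : ∀ r → ⟦ γ ⁻¹ ⟧ (⟦ α ⟧ r) ≡ M r (⟦ β ⁻¹ ⟧ (⟦ α ⟧ r))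
  diagonal r = begin
    ⟦ γ ⁻¹ ⟧ x                              ≡⟨ cong ⟦ γ ⁻¹ ⟧ (sym (idempotent x)) ⟩
    ⟦ γ ⁻¹ ⟧ (x + x)                        ≡⟨ cong (λ y → ⟦ γ ⁻¹ ⟧ (x + y)) (sym (right-cancel β x)) ⟩
    ⟦ γ ⁻¹ ⟧ (⟦ α ⟧ r + ⟦ β ⟧ c)            ≡⟨ cong ⟦ γ ⁻¹ ⟧ (isotopy r c) ⟩
    ⟦ γ ⁻¹ ⟧ (⟦ γ ⟧ (M r c))                ≡⟨ left-cancel γ (M r c) ⟩
    M r c                                   ∎
    where
    open ≡-Reasoning
    x : Fin _
    x = ⟦ α ⟧ r
    c : Fin _
    c = ⟦ β ⁻¹ ⟧ x

mainTheorem7 : (n : ℕ) (M : Array n) → P₁ M →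
    HasTransversal M ⇔ Σ (Op n) (λ _+_ → Idempotent _+_ × Isotopic _+_ M)
mainTheorem7 n M _ =
  mk⇔ (transversal⇒idempotentIsotope M) (idempotentIsotope⇒transversal M)
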